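{- Let $\Lambda_X=(\mathcal{L}_X,\mathfrak{M}_X,\models_X)$ be the satisfaction system of the NeXt fragment of LTL. For $B\in\mathcal{P}_{\mathrm{fin}}(\mathcal{L}_X)$ and $\mathbb{M}\subseteq\mathfrak{M}_X$ define $\oplus_X(B,\mathbb{M})=\{\varphi\in B\mid (M,s)\models_X\varphi$ for all $(M,s)\in\mathbb{M}\}$. Then $\mathrm{Mod}(\oplus_X(B,\mathbb{M}))\in\mathrm{FRsups}(\mathrm{Mod}(B)\cup\mathbb{M},\Lambda_X)$ for all such $B$ and $\mathbb{M}$.
   Context: Fix a non-empty set $\mathcal{P}$ of propositional atoms. $\mathcal{L}_X$ is given by $\varphi::=p\mid X\varphi$ with $p\in\mathcal{P}$; so every formula is $X^n p$ ($X$ nested $n\ge0$ times). A Kripke structure is $M=(S,R,\lambda)$ with $S$ a non-empty finite set of states, $R\subseteq S\times S$ total (every state has a successor), $\lambda:S\to\mathcal{P}(\mathcal{P})$. $\mathfrak{M}_X$ is the set of pairs $(M,s)$ with $M$ a Kripke structure and $s$ a state of $M$. $(M,s)\models_X X^ip$ iff for every path $s_0s_1s_2\ldots$ of $M$ with $s_0=s$ and $(s_j,s_{j+1})\in R$, $p\in\lambda(s_i)$; $(M,s)\models_X B$ iff $(M,s)\models_X\varphi$ for all $\varphi\in B$. For a satisfaction system $\Lambda=(\mathcal{L},\mathfrak{M},\models)$: $\mathrm{Mod}(B)=\{m\in\mathfrak{M}\mid m\models B\}$; $\mathcal{P}_{\mathrm{fin}}(\mathcal{L})$ is the set of finite subsets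 of $\mathcal{L}$; $\mathrm{FR}(\Lambda)=\{\mathrm{Mod}(B)\mid B\in\mathcal{P}_{\mathrm{fin}}(\mathcal{L})\}$; $\mathrm{FRsups}(\mathbb{M},\Lambda)$ is the set of $\subseteq$-minimal elements of $\{Y\in\mathrm{FR}(\Lambda)\mid\mathbb{M}\subseteq Y\}$. -}

module Defs where

open import Level using (Level; 0ℓ) renaming (suc to lsuc)
open import Data.Nat using (ℕ; zero; suc)
open import Data.Fin using (Fin)
open import Data.Product using (Σ; ∃; _×_)
open import Data.List using (List)
open import Data.List.Membership.Propositional using (_∈_)
open import Relation.Binary.PropositionalEquality using (_≡_)
open import Relation.Unary using (Pred; _⊆_; _⊄_; _≐_; _∪_)

data Form (Atom : Set) : Set where
  atom : Atom → Form Atom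
  X    : Form Atom → Form Atom

depth : ∀ {Atom} → Form Atom → ℕ
depth (atom p) = zero
depth (X φ)    = suc (depth φ)

base : ∀ {Atom} → Form Atom → Atom
base (atom p) = p
base (X φ)    = base φ

record Kripke (Atom : Set) : Set₁ where
  field
    n     : ℕ
    R     : Fin (suc n) → Fin (suc n) → Set
    total : ∀ s → ∃ λ t → R s t
    lab   : Fin (suc n) → Pred Atom 0ℓ

  State : Set
  State = Fin (suc n)

record PModel (Atom : Set) : Set₁ where
  constructor _,_
  field
    M : Kripke Atom
    s : Kripke.State M

Path : ∀ {Atom} (M : Kripke Atom) → Kripke.State M → Set
Path M s = Σ (ℕ → Kripke.State M) λ π →
  (π 0 ≡ s) × (∀ j → Kripke.R M (π j) (π (suc j)))

_⊨_ : ∀ {Atom} → PModel Atom → Form Atom → Set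
(M , s) ⊨ φ = (π : Path M s) → Kripke.lab M (Σ.proj₁ π (depth φ)) (base φ)

Mod : ∀ {Atom} → List (Form Atom) → Pred (PModel Atom) 0ℓ
Mod B m = ∀ φ → φ ∈ B → m ⊨ φ

ModP : ∀ {Atom} {ℓ : Level} → Pred (Form Atom) ℓ → Pred (PModel Atom) ℓ
ModP Φ m = ∀ φ → Φ φ → m ⊨ φ

⊕X : ∀ {Atom} → List (Form Atom) → Pred (PModel Atom) 0ℓ → Pred (Form Atom) (lsuc 0ℓ)
⊕X B 𝕄 φ = (φ ∈ B) × (∀ m → 𝕄 m → m ⊨ φ)

InFR : ∀ {Atom} {ℓ : Level} → Pred (PModel Atom) ℓ → Set (lsuc 0ℓ Level.⊔ ℓ)
InFR {Atom} Y = ∃ λ (B' : List (Form Atom)) → Mod B' ≐ Y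

-- Y ∈ FRsups(𝕄', Λ_X): Y is a ⊆-minimal element of {Y ∈ FR | 𝕄' ⊆ Y}
-- (every element of FR is of the form Mod(B'), so minimality quantifies over B')
InFRsups : ∀ {Atom} {ℓ ℓ' : Level} → Pred (PModel Atom) ℓ' → Pred (PModel Atom) ℓ → Set _
InFRsups {Atom} 𝕄' Y =
  InFR Y × (𝕄' ⊆ Y) ×
  (∀ (B' : List (Form Atom)) → 𝕄' ⊆ Mod B' → Mod B' ⊄ Y)

-- ⊕X(B, 𝕄) keeps exactly the members of B true throughout 𝕄, so Mod(⊕X(B, 𝕄)) contains Mod(B) ∪ 𝕄,
-- and with excluded middle ⊕X(B, 𝕄) is the finite set obtained by filtering B.  For minimality, the
-- crucial fact is that in the NeXt fragment a finite B entails X^i p only when X^i p itself is in B: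
-- the pointed chain 0 → 1 → … → i → i+1 ⟲, whose state j < i+1 carries exactly the atoms q with X^j q ∈ B
-- and whose sink i+1 carries every atom, is a model of B.  Hence if Mod(B) ∪ 𝕄 ⊆ Mod(B'), every
-- ψ ∈ B' lies in B and holds throughout 𝕄, i.e. ψ ∈ ⊕X(B, 𝕄), and so Mod(⊕X(B, 𝕄)) ⊆ Mod(B').
module Submission where

open import Defs
open import Level using (0ℓ) renaming (suc to lsuc)
open import Data.List using (List; filter)
open import Data.List.Membership.Propositional using (_∈_)
open import Data.List.Membership.Propositional.Properties using (∈-filter⁺; ∈-filter⁻)
open import Relation.Unary using (Pred; Decidable; _∪_; _⊆_; _≐_)
open import Axiom.ExcludedMiddle using (ExcludedMiddle)
open import Data.Nat using (ℕ; zero; suc; _⊓_; s≤s)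
open import Data.Nat.Properties using (⊓-sel; m⊓n≤n; m≤n⇒m⊓n≡m; n≤1+n; 1+n≢n)
open import Data.Fin using (toℕ; fromℕ<) renaming (zero to fzero)
open import Data.Fin.Properties using (toℕ-fromℕ<)
open import Data.Product using (Σ-syntax; _×_; _,_; proj₁; proj₂)
open import Data.Sum using (_⊎_; inj₁; inj₂)
open import Relation.Nullary using (contradiction)
open import Relation.Binary.PropositionalEquality
  using (_≡_; refl; sym; trans; cong; subst₂; module ≡-Reasoning)

suc[m⊓n]⊓n≡suc[m]⊓n : ∀ m n → suc (m ⊓ n) ⊓ n ≡ suc m ⊓ n
suc[m⊓n]⊓n≡suc[m]⊓n zero    n       = refl
suc[m⊓n]⊓n≡suc[m]⊓n (suc m) zero    = refl
suc[m⊓n]⊓n≡suc[m]⊓n (suc m) (suc n) = cong suc (suc[m⊓n]⊓n≡suc[m]⊓n m n)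

module _ {Atom : Set} where

  ⊨-resp-shape : ∀ m {φ ψ : Form Atom} → depth φ ≡ depth ψ → base φ ≡ base ψ → m ⊨ φ → m ⊨ ψ
  ⊨-resp-shape (M , s) depth≡ base≡ m⊨φ π =
    subst₂ (λ i p → Kripke.lab M (proj₁ π i) p) depth≡ base≡ (m⊨φ π)

  Occurs : List (Form Atom) → ℕ → Atom → Set
  Occurs B i p = Σ[ φ ∈ Form Atom ] φ ∈ B × depth φ ≡ i × base φ ≡ p

  path-from : (M : Kripke Atom) (s : Kripke.State M) → Path M s
  path-from M s = walk , refl , λ j → proj₂ (Kripke.total M (walk j))
    where
    walk : ℕ → Kripke.State M
    walk zero    = s
    walk (suc j) = proj₁ (Kripke.total M (walk j))

  chain : List (Form Atom) → ℕ → Kripke Atom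
  chain B d = record
    { n     = suc d
    ; R     = λ s t → toℕ t ≡ suc (toℕ s) ⊓ suc d
    ; total = λ s → let bounded = s≤s (m⊓n≤n (suc (toℕ s)) (suc d)) in fromℕ< bounded , toℕ-fromℕ< bounded
    ; lab   = λ s p → toℕ s ≡ suc d ⊎ Occurs B (toℕ s) p
    }

  chain-path : ∀ B d (π : Path (chain B d) fzero) i → toℕ (proj₁ π i) ≡ i ⊓ suc d
  chain-path B d (π , π₀ , step) zero    = cong toℕ π₀
  chain-path B d (π , π₀ , step) (suc i) = begin
    toℕ (π (suc i))           ≡⟨ step i ⟩
    suc (toℕ (π i)) ⊓ suc d   ≡⟨ cong (λ k → suc k ⊓ suc d) (chain-path B d (π , π₀ , step) i) ⟩
    suc (i ⊓ suc d) ⊓ suc d   ≡⟨ suc[m⊓n]⊓n≡suc[m]⊓n i (suc d) ⟩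
    suc i ⊓ suc d             ∎
    where open ≡-Reasoning

  chain-⊨ : ∀ B d → Mod B (chain B d , fzero)
  chain-⊨ B d φ φ∈B π with ⊓-sel (depth φ) (suc d)
  ... | inj₁ capped = inj₂ (φ , φ∈B , sym (trans (chain-path B d π (depth φ)) capped) , refl)
  ... | inj₂ sunk   = inj₁ (trans (chain-path B d π (depth φ)) sunk)

  entailed⇒occurs : ∀ B ψ → Mod B ⊆ (_⊨ ψ) → Occurs B (depth ψ) (base ψ)
  entailed⇒occurs B ψ B⊨ψ = occurs (B⊨ψ {chain B d , fzero} (chain-⊨ B d) π)
    where
    d = depth ψ
    π = path-from (chain B d) fzero

    position : toℕ (proj₁ π d) ≡ d
    position = trans (chain-path B d π d) (m≤n⇒m⊓n≡m (n≤1+n d))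

    occurs : Kripke.lab (chain B d) (proj₁ π d) (base ψ) → Occurs B d (base ψ)
    occurs (inj₁ sunk)                       = contradiction (trans (sym sunk) position) 1+n≢n
    occurs (inj₂ (φ , φ∈B , depth≡ , base≡)) = φ , φ∈B , trans depth≡ position , base≡

  Mod-filter : ∀ {ℓ} {P : Pred (Form Atom) ℓ} (P? : Decidable P) B →
               Mod (filter P? B) ≐ ModP (λ φ → φ ∈ B × P φ)
  Mod-filter P? B = (λ m⊨ φ (φ∈B , Pφ) → m⊨ φ (∈-filter⁺ P? φ∈B Pφ))
                  , (λ m⊨ φ φ∈ → m⊨ φ (∈-filter⁻ P? φ∈))

  module _ (B : List (Form Atom)) (𝕄 : Pred (PModel Atom) 0ℓ) where

    ⊕X-sound : Mod B ∪ 𝕄 ⊆ ModP (⊕X B 𝕄)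
    ⊕X-sound (inj₁ m⊨B) φ (φ∈B , _)  = m⊨B φ φ∈B
    ⊕X-sound (inj₂ m∈𝕄) φ (_ , 𝕄⊨φ) = 𝕄⊨φ _ m∈𝕄

    ⊕X-strongest : ∀ B' → Mod B ∪ 𝕄 ⊆ Mod B' → ModP (⊕X B 𝕄) ⊆ Mod B'
    ⊕X-strongest B' ⊆B' {m} m⊨⊕X ψ ψ∈B'
      with entailed⇒occurs B ψ (λ {m′} m′⊨B → ⊆B' {m′} (inj₁ m′⊨B) ψ ψ∈B')
    ... | φ , φ∈B , depth≡ , base≡ = ⊨-resp-shape m depth≡ base≡ (m⊨⊕X φ (φ∈B , 𝕄⊨φ))
      where
      𝕄⊨φ : ∀ m → 𝕄 m → m ⊨ φ
      𝕄⊨φ m′ m′∈𝕄 = ⊨-resp-shape m′ (sym depth≡) (sym base≡) (⊆B' {m′} (inj₂ m′∈𝕄) ψ ψ∈B')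

proposition7 : ExcludedMiddle (lsuc 0ℓ) →
    (Atom : Set) → Atom →
    (B : List (Form Atom)) → (𝕄 : Pred (PModel Atom) 0ℓ) →
    InFRsups (Mod B ∪ 𝕄) (ModP (⊕X B 𝕄))
proposition7 lem Atom _ B 𝕄 =
    (filter (λ _ → lem) B , Mod-filter (λ _ → lem) B)
  , ⊕X-sound B 𝕄
  , λ B' ⊆B' (_ , ⊕X⊈B') → ⊕X⊈B' (λ {m} → ⊕X-strongest B 𝕄 B' ⊆B' {m})
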